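{- Let $n,q,k,r$ be integers with $n\ge2k+1\ge5$, $q\ge1$ and $0\le r\le k-1$, and suppose $\chi_{qk-r}(K(n,k))\le qn-2r-1$. Then for all integers $r',q'$ with $r\le r'\le k-1$ and $q'\ge q+r'-r$ we have $\chi_{q'k-r'}(K(n,k))\le q'n-2r'-1$.
   Context: For integers $n\ge k\ge 1$, the Kneser graph $K(n,k)$ has as vertices all $k$-element subsets of $[n]=\{1,\dots,n\}$, two vertices being adjacent iff the subsets are disjoint. A graph $G$ is $(n,k)$-colourable if each vertex can be assigned a $k$-subset of $[n]$ so that adjacent vertices receive disjoint subsets. The $k$-th multi-chromatic number $\chi_k(G)$ is the smallest $n$ such that $G$ is $(n,k)$-colourable. -}

module Defs where

open import Data.Nat using (ℕ; _≤_)
open import Data.Fin.Subset using (Subset; ∣_∣; _∩_; ⊥)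
open import Data.Product using (Σ; ∃; _×_)
open import Relation.Binary.PropositionalEquality using (_≡_)

KSubset : ℕ → ℕ → Set
KSubset n k = Σ (Subset n) (λ s → ∣ s ∣ ≡ k)

Disjoint : ∀ {n} → Subset n → Subset n → Set
Disjoint s t = s ∩ t ≡ ⊥

record Graph : Set₁ where
  field
    V   : Set
    Adj : V → V → Set

Kneser : ℕ → ℕ → Graph
Kneser n k = record
  { V   = KSubset n k
  ; Adj = λ s t → Disjoint (Σ.proj₁ s) (Σ.proj₁ t)
  }

Colourable : Graph → ℕ → ℕ → Set
Colourable G m j =
  Σ (Graph.V G → KSubset m j) λ c →
    ∀ u v → Graph.Adj G u v → Disjoint (Σ.proj₁ (c u)) (Σ.proj₁ (c v))

-- χ_j(G) ≤ m : the least m' with G (m',j)-colourable is ≤ m,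
-- i.e. some m' ≤ m admits an (m',j)-colouring
χ≤ : Graph → ℕ → ℕ → Set
χ≤ G j m = ∃ λ m' → m' ≤ m × Colourable G m' j

{-# OPTIONS --safe #-}

-- Colourings of one graph can be concatenated, adding both the palettes and the sizes of the
-- colour sets. K(n,k) is (n,k)-colourable by the identity and (n − 2, k − 1)-colourable by
-- Stahl's map. Appending d Stahl colourings and e identity colourings to a (qk − r)-fold
-- colouring with qn − 2r − 1 colours gives a ((q+d+e)k − (r+d))-fold colouring with
-- (q+d+e)n − 2(r+d) − 1 colours.

module Submission where

open import Defs
open import Data.Nat using (ℕ; zero; suc; _+_; _*_; _∸_; _≤_; _<_; s≤s; z≤n; z<s; >-nonZero)
open import Data.Nat.Properties
open import Data.Nat.Tactic.RingSolver using (solve-∀)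
open import Data.Fin.Subset using (Subset; inside; outside; ∣_∣)
open import Data.Fin.Subset.Properties using (∩-comm)
open import Data.Vec using ([]; _∷_; _++_)
open import Data.Vec.Properties using (∷-injectiveˡ; ∷-injectiveʳ)
open import Data.Product using (_,_; proj₁; proj₂)
open import Relation.Binary.PropositionalEquality
open ≡-Reasoning

Disjoint-sym : ∀ {n} {p q : Subset n} → Disjoint p q → Disjoint q p
Disjoint-sym {p = p} {q} p∩q≡⊥ = trans (∩-comm q p) p∩q≡⊥

Disjoint-++ : ∀ {a b} (p q : Subset a) {p′ q′ : Subset b} →
  Disjoint p q → Disjoint p′ q′ → Disjoint (p ++ p′) (q ++ q′)
Disjoint-++ []      []      _ d′ = d′
Disjoint-++ (x ∷ p) (y ∷ q) d d′ = cong₂ _∷_ (∷-injectiveˡ d) (Disjoint-++ p q (∷-injectiveʳ d) d′)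

∣p++q∣≡∣p∣+∣q∣ : ∀ {a b} (p : Subset a) (q : Subset b) → ∣ p ++ q ∣ ≡ ∣ p ∣ + ∣ q ∣
∣p++q∣≡∣p∣+∣q∣ []            q = refl
∣p++q∣≡∣p∣+∣q∣ (inside  ∷ p) q = cong suc (∣p++q∣≡∣p∣+∣q∣ p q)
∣p++q∣≡∣p∣+∣q∣ (outside ∷ p) q = ∣p++q∣≡∣p∣+∣q∣ p q

removeLeast : ∀ {n} → Subset n → Subset n
removeLeast []            = []
removeLeast (inside  ∷ p) = outside ∷ p
removeLeast (outside ∷ p) = outside ∷ removeLeast p

addLeastAbsent : ∀ {n} → Subset n → Subset n
addLeastAbsent []            = []
addLeastAbsent (outside ∷ p) = inside ∷ p
addLeastAbsent (inside  ∷ p) = inside ∷ addLeastAbsent p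

∣removeLeast∣ : ∀ {n k} (p : Subset n) → ∣ p ∣ ≡ suc k → ∣ removeLeast p ∣ ≡ k
∣removeLeast∣ (inside  ∷ p) ∣p∣≡1+k = suc-injective ∣p∣≡1+k
∣removeLeast∣ (outside ∷ p) ∣p∣≡1+k = ∣removeLeast∣ p ∣p∣≡1+k

∣addLeastAbsent∣ : ∀ {n} (p : Subset n) → ∣ p ∣ < n → ∣ addLeastAbsent p ∣ ≡ suc ∣ p ∣
∣addLeastAbsent∣ (outside ∷ p) _         = refl
∣addLeastAbsent∣ (inside  ∷ p) (s≤s ∣p∣<n) = cong suc (∣addLeastAbsent∣ p ∣p∣<n)

removeLeast-Disjointˡ : ∀ {n} (p q : Subset n) → Disjoint p q → Disjoint (removeLeast p) q
removeLeast-Disjointˡ []            []      _ = refl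
removeLeast-Disjointˡ (inside  ∷ p) (_ ∷ q) d = cong (outside ∷_) (∷-injectiveʳ d)
removeLeast-Disjointˡ (outside ∷ p) (_ ∷ q) d = cong (outside ∷_) (removeLeast-Disjointˡ p q (∷-injectiveʳ d))

removeLeast-Disjointʳ : ∀ {n} (p q : Subset n) → Disjoint p q → Disjoint p (removeLeast q)
removeLeast-Disjointʳ p q d = Disjoint-sym (removeLeast-Disjointˡ q p (Disjoint-sym d))

-- The least element of p is absent from q, so the least element absent from q is either it
-- (and then removed from p) or smaller than every element of p.
removeLeast-addLeastAbsent-Disjoint : ∀ {n} (p q : Subset n) →
  Disjoint p q → Disjoint (removeLeast p) (addLeastAbsent q)
removeLeast-addLeastAbsent-Disjoint []            []            _  = refl
removeLeast-addLeastAbsent-Disjoint (inside  ∷ p) (inside  ∷ q) ()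
removeLeast-addLeastAbsent-Disjoint (inside  ∷ p) (outside ∷ q) d = cong (outside ∷_) (∷-injectiveʳ d)
removeLeast-addLeastAbsent-Disjoint (outside ∷ p) (outside ∷ q) d =
  cong (outside ∷_) (removeLeast-Disjointˡ p q (∷-injectiveʳ d))
removeLeast-addLeastAbsent-Disjoint (outside ∷ p) (inside  ∷ q) d =
  cong (outside ∷_) (removeLeast-addLeastAbsent-Disjoint p q (∷-injectiveʳ d))

addLeastAbsent-removeLeast-Disjoint : ∀ {n} (p q : Subset n) →
  Disjoint p q → Disjoint (addLeastAbsent p) (removeLeast q)
addLeastAbsent-removeLeast-Disjoint p q d =
  Disjoint-sym (removeLeast-addLeastAbsent-Disjoint q p (Disjoint-sym d))

-- Stahl's map K(m + 2, k + 1) → K(m, k): forget the first two points, then restore the size by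
-- removing the least remaining element or adding the least absent one.
stahl : ∀ {m} → Subset (suc (suc m)) → Subset m
stahl (outside ∷ outside ∷ p) = removeLeast p
stahl (inside  ∷ outside ∷ p) = p
stahl (outside ∷ inside  ∷ p) = p
stahl (inside  ∷ inside  ∷ p) = addLeastAbsent p

∣stahl∣ : ∀ {m k} (p : Subset (suc (suc m))) → k ≤ m → ∣ p ∣ ≡ suc k → ∣ stahl p ∣ ≡ k
∣stahl∣ (outside ∷ outside ∷ p) _   ∣p∣≡1+k = ∣removeLeast∣ p ∣p∣≡1+k
∣stahl∣ (inside  ∷ outside ∷ p) _   refl    = refl
∣stahl∣ (outside ∷ inside  ∷ p) _   refl    = refl
∣stahl∣ (inside  ∷ inside  ∷ p) k≤m refl    = ∣addLeastAbsent∣ p k≤m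

stahl-Disjoint : ∀ {m} (p q : Subset (suc (suc m))) → Disjoint p q → Disjoint (stahl p) (stahl q)
stahl-Disjoint (outside ∷ outside ∷ p) (outside ∷ outside ∷ q) d =
  removeLeast-Disjointʳ _ q (removeLeast-Disjointˡ p q (∷-injectiveʳ (∷-injectiveʳ d)))
stahl-Disjoint (outside ∷ outside ∷ p) (inside  ∷ outside ∷ q) d =
  removeLeast-Disjointˡ p q (∷-injectiveʳ (∷-injectiveʳ d))
stahl-Disjoint (outside ∷ outside ∷ p) (outside ∷ inside  ∷ q) d =
  removeLeast-Disjointˡ p q (∷-injectiveʳ (∷-injectiveʳ d))
stahl-Disjoint (outside ∷ outside ∷ p) (inside  ∷ inside  ∷ q) d =
  removeLeast-addLeastAbsent-Disjoint p q (∷-injectiveʳ (∷-injectiveʳ d))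
stahl-Disjoint (inside  ∷ outside ∷ p) (outside ∷ outside ∷ q) d =
  removeLeast-Disjointʳ p q (∷-injectiveʳ (∷-injectiveʳ d))
stahl-Disjoint (outside ∷ inside  ∷ p) (outside ∷ outside ∷ q) d =
  removeLeast-Disjointʳ p q (∷-injectiveʳ (∷-injectiveʳ d))
stahl-Disjoint (inside  ∷ outside ∷ p) (outside ∷ inside  ∷ q) d = ∷-injectiveʳ (∷-injectiveʳ d)
stahl-Disjoint (outside ∷ inside  ∷ p) (inside  ∷ outside ∷ q) d = ∷-injectiveʳ (∷-injectiveʳ d)
stahl-Disjoint (inside  ∷ inside  ∷ p) (outside ∷ outside ∷ q) d =
  addLeastAbsent-removeLeast-Disjoint p q (∷-injectiveʳ (∷-injectiveʳ d))
stahl-Disjoint (inside  ∷ _       ∷ p) (inside  ∷ _       ∷ q) ()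
stahl-Disjoint (_       ∷ inside  ∷ p) (_       ∷ inside  ∷ q) ()

Colourable-+ : ∀ {G m m′ j j′} → Colourable G m j → Colourable G m′ j′ → Colourable G (m + m′) (j + j′)
Colourable-+ (c , c-proper) (c′ , c′-proper) =
  (λ v → proj₁ (c v) ++ proj₁ (c′ v) ,
         trans (∣p++q∣≡∣p∣+∣q∣ (proj₁ (c v)) (proj₁ (c′ v))) (cong₂ _+_ (proj₂ (c v)) (proj₂ (c′ v)))) ,
  λ u v adj → Disjoint-++ (proj₁ (c u)) (proj₁ (c v)) (c-proper u v adj) (c′-proper u v adj)

Colourable-* : ∀ {G m j} d → Colourable G m j → Colourable G (d * m) (d * j)
Colourable-* zero    _ = (λ _ → [] , refl) , λ _ _ _ → refl
Colourable-* (suc d) c = Colourable-+ c (Colourable-* d c)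

χ≤-+ : ∀ {G m j a b} → Colourable G m j → χ≤ G a b → χ≤ G (a + j) (b + m)
χ≤-+ {m = m} c (m′ , m′≤b , c′) = m′ + m , +-monoˡ-≤ m m′≤b , Colourable-+ c′ c

Kneser-Colourable : ∀ {n k} → Colourable (Kneser n k) n k
Kneser-Colourable = (λ v → v) , λ _ _ adj → adj

Kneser-Colourable-stahl : ∀ {m k} → k ≤ m → Colourable (Kneser (suc (suc m)) (suc k)) m k
Kneser-Colourable-stahl k≤m =
  (λ (p , ∣p∣≡1+k) → stahl p , ∣stahl∣ p k≤m ∣p∣≡1+k) ,
  λ (p , _) (q , _) → stahl-Disjoint p q

KneserBound : (n k q r : ℕ) → Set
KneserBound n k q r = χ≤ (Kneser n k) (q * k ∸ r) (q * n ∸ 2 * r ∸ 1)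

∸-regroup : ∀ {c t s} q d e → s ≤ q * (c + t) →
  (q + d + e) * (c + t) ∸ (d * c + s) ≡ (q * (c + t) ∸ s) + d * t + e * (c + t)
∸-regroup {c} {t} {s} q d e s≤q[c+t] = begin
  (q + d + e) * (c + t) ∸ (d * c + s)
    ≡⟨ cong (_∸ (d * c + s)) (expand q d e c t) ⟩
  d * c + (q * (c + t) + (d * t + e * (c + t))) ∸ (d * c + s)
    ≡⟨ [m+n]∸[m+o]≡n∸o (d * c) _ s ⟩
  q * (c + t) + (d * t + e * (c + t)) ∸ s
    ≡⟨ +-∸-comm (d * t + e * (c + t)) s≤q[c+t] ⟩
  (q * (c + t) ∸ s) + (d * t + e * (c + t))
    ≡⟨ sym (+-assoc _ (d * t) (e * (c + t))) ⟩
  (q * (c + t) ∸ s) + d * t + e * (c + t) ∎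
  where
  expand : ∀ q d e c t → (q + d + e) * (c + t) ≡ d * c + (q * (c + t) + (d * t + e * (c + t)))
  expand = solve-∀

KneserBound-shift : ∀ {n k q r} → 0 < k → k < n → r ≤ q * k → 2 * r + 1 ≤ q * n →
  KneserBound n k q r → ∀ d e → KneserBound n k (q + d + e) (r + d)
KneserBound-shift {suc (suc m)} {suc k} {q} {r} (s≤s z≤n) (s≤s (s≤s k≤m)) r≤qk 2r+1≤qn bound d e =
  subst₂ (χ≤ (Kneser _ _)) (sym colours) (sym palette)
    (χ≤-+ (Colourable-* e Kneser-Colourable)
      (χ≤-+ (Colourable-* d (Kneser-Colourable-stahl k≤m)) bound))
  where
  r+d≡d*1+r : ∀ r d → r + d ≡ d * 1 + r
  r+d≡d*1+r = solve-∀
  2[r+d]+1≡d*2+[2r+1] : ∀ r d → 2 * (r + d) + 1 ≡ d * 2 + (2 * r + 1)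
  2[r+d]+1≡d*2+[2r+1] = solve-∀
  colours : (q + d + e) * suc k ∸ (r + d) ≡ (q * suc k ∸ r) + d * k + e * suc k
  colours = begin
    (q + d + e) * suc k ∸ (r + d)     ≡⟨ cong ((q + d + e) * suc k ∸_) (r+d≡d*1+r r d) ⟩
    (q + d + e) * suc k ∸ (d * 1 + r) ≡⟨ ∸-regroup q d e r≤qk ⟩
    (q * suc k ∸ r) + d * k + e * suc k ∎
  palette : (q + d + e) * suc (suc m) ∸ 2 * (r + d) ∸ 1
          ≡ (q * suc (suc m) ∸ 2 * r ∸ 1) + d * m + e * suc (suc m)
  palette = begin
    (q + d + e) * suc (suc m) ∸ 2 * (r + d) ∸ 1
      ≡⟨ ∸-+-assoc _ (2 * (r + d)) 1 ⟩
    (q + d + e) * suc (suc m) ∸ (2 * (r + d) + 1)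
      ≡⟨ cong ((q + d + e) * suc (suc m) ∸_) (2[r+d]+1≡d*2+[2r+1] r d) ⟩
    (q + d + e) * suc (suc m) ∸ (d * 2 + (2 * r + 1))
      ≡⟨ ∸-regroup q d e 2r+1≤qn ⟩
    (q * suc (suc m) ∸ (2 * r + 1)) + d * m + e * suc (suc m)
      ≡⟨ cong (λ x → x + d * m + e * suc (suc m)) (sym (∸-+-assoc _ (2 * r) 1)) ⟩
    (q * suc (suc m) ∸ 2 * r ∸ 1) + d * m + e * suc (suc m) ∎

KneserBound-mono : ∀ {n k q r q′ r′} → 0 < k → k < n → r ≤ q * k → 2 * r + 1 ≤ q * n →
  KneserBound n k q r → r ≤ r′ → q + (r′ ∸ r) ≤ q′ → KneserBound n k q′ r′
KneserBound-mono {q = q} {r} {q′} 0<k k<n r≤qk 2r+1≤qn bound r≤r′ q+[r′∸r]≤q′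
  with d , refl ← m≤n⇒∃[o]m+o≡n r≤r′
  with e , refl ← m≤n⇒∃[o]m+o≡n (subst (λ x → q + x ≤ q′) (m+n∸m≡n r d) q+[r′∸r]≤q′)
  = KneserBound-shift {q = q} 0<k k<n r≤qk 2r+1≤qn bound d e

corollary3p7 : (n q k r : ℕ) → 2 * k + 1 ≤ n → 5 ≤ 2 * k + 1 → 1 ≤ q → r + 1 ≤ k →
    χ≤ (Kneser n k) (q * k ∸ r) (q * n ∸ 2 * r ∸ 1) →
    (r' q' : ℕ) → r ≤ r' → r' + 1 ≤ k → q + r' ∸ r ≤ q' →
    χ≤ (Kneser n k) (q' * k ∸ r') (q' * n ∸ 2 * r' ∸ 1)
corollary3p7 n q k r 2k+1≤n _ 1≤q r+1≤k bound r' q' r≤r' _ q+r'∸r≤q' =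
  KneserBound-mono {q = q} (m+n≤o⇒n≤o r r+1≤k) k<n r≤qk 2r+1≤qn bound r≤r'
    (subst (_≤ q') (+-∸-assoc q r≤r') q+r'∸r≤q')
  where
  instance _ = >-nonZero 1≤q
  k<n : k < n
  k<n = <-≤-trans (≤-<-trans (m≤n*m k 2) (m<m+n (2 * k) z<s)) 2k+1≤n
  r≤k : r ≤ k
  r≤k = m+n≤o⇒m≤o r r+1≤k
  r≤qk : r ≤ q * k
  r≤qk = ≤-trans r≤k (m≤n*m k q)
  2r+1≤qn : 2 * r + 1 ≤ q * n
  2r+1≤qn = ≤-trans (+-monoˡ-≤ 1 (*-monoʳ-≤ 2 r≤k)) (≤-trans 2k+1≤n (m≤n*m n q))
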